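{- For integers $n\ge m\ge 2$ and $0\le g\le \lfloor (m+n-4)/2\rfloor-1$, $$n+m-1+g\le c^{g}(K_n\square K_m)\le (g+1)(m-1)+n.$$ Moreover, the bounds are sharp.
   Context: $K_n$ is the complete graph on $n$ vertices and $\square$ the Cartesian product: $(u,v)\sim(u',v')$ iff ($u=u'$ and $vv'$ is an edge of the second factor) or ($v=v'$ and $uu'$ is an edge of the first factor). For a graph $\Gamma$ and integer $g\ge0$, a set $X\subseteq V(\Gamma)$ is a $g$-good-neighbor cut if $\Gamma-X$ is disconnected and every vertex outside $X$ has at least $g$ neighbors outside $X$. For such $X$ and a component $C$ of $\Gamma-X$, $C$ is splittable if $V(C)$ partitions into nonempty $A,B$ with $\delta(\Gamma[A]),\delta(\Gamma[B])\ge g$; among such partitions with $|A|\ge|B|$ minimizing $|A|-|B|$ set $a(C)=|A|$. $a(X)=\min a(C)$ over splittable components, $c(X)=$ minimum order of a non-splittable component (minima over empty sets $+\infty$), and the gc number is $c^g(\Gamma)=\min_X\{|X|+\min\{a(X),c(X)\}\}$ over all $g$-good-neighbor cuts $X$. -}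

module Defs where

open import Data.Nat using (ℕ; _+_; _*_; _∸_; _≤_)
open import Data.Bool using (Bool; true; false; not; _∧_; _∨_)
open import Data.Fin using (Fin; remQuot)
open import Data.Fin.Properties using (_≟_)
open import Data.Fin.Subset using (Subset; _∈_; _∉_; _⊆_; ∁; _∩_; _∪_; ∣_∣; Nonempty; Empty)
open import Data.Vec using (tabulate)
open import Data.Product using (Σ; ∃; ∃-syntax; _×_; _,_)
open import Data.Sum using (_⊎_)
open import Relation.Nullary using (¬_)
open import Relation.Nullary.Decidable using (⌊_⌋)
open import Relation.Binary.PropositionalEquality using (_≡_)

record Graph : Set where
  field
    N   : ℕ
    adj : Fin N → Fin N → Bool
open Graph public

K : ℕ → Graph
K n = record { N = n ; adj = λ i j → not ⌊ i ≟ j ⌋ }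

_□_ : Graph → Graph → Graph
G □ H = record { N = N G * N H ; adj = a }
  where
  a : Fin (N G * N H) → Fin (N G * N H) → Bool
  a i j with remQuot (N H) i | remQuot (N H) j
  ... | (u , v) | (u' , v') =
        (⌊ u ≟ u' ⌋ ∧ adj H v v') ∨ (⌊ v ≟ v' ⌋ ∧ adj G u u')

module _ (Γ : Graph) where
  private V = Fin (N Γ)

  nbr : V → Subset (N Γ)
  nbr x = tabulate (adj Γ x)

  degIn : Subset (N Γ) → V → ℕ
  degIn S x = ∣ S ∩ nbr x ∣

  MinDegAtLeast : ℕ → Subset (N Γ) → Set
  MinDegAtLeast g S = ∀ x → x ∈ S → g ≤ degIn S x

  data Reach (S : Subset (N Γ)) : V → V → Set where
    here : ∀ {x} → x ∈ S → Reach S x x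
    step : ∀ {x y z} → x ∈ S → adj Γ x y ≡ true → Reach S y z → Reach S x z

  Connected : Subset (N Γ) → Set
  Connected S = ∀ x y → x ∈ S → y ∈ S → Reach S x y

  Disconnected : Subset (N Γ) → Set
  Disconnected S = ∃[ x ] ∃[ y ] (x ∈ S × y ∈ S × ¬ Reach S x y)

  IsComponent : Subset (N Γ) → Subset (N Γ) → Set
  IsComponent S C =
    C ⊆ S × Nonempty C × Connected C ×
    (∀ x y → x ∈ C → y ∈ S → adj Γ x y ≡ true → y ∈ C)

  GoodNeighborCut : ℕ → Subset (N Γ) → Set
  GoodNeighborCut g X = Disconnected (∁ X) × MinDegAtLeast g (∁ X)

  SplitPair : ℕ → Subset (N Γ) → Subset (N Γ) → Subset (N Γ) → Set
  SplitPair g C A B =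
    A ∪ B ≡ C × Empty (A ∩ B) × Nonempty A × Nonempty B ×
    MinDegAtLeast g A × MinDegAtLeast g B

  Splittable : ℕ → Subset (N Γ) → Set
  Splittable g C = ∃[ A ] ∃[ B ] SplitPair g C A B

  AValue : ℕ → Subset (N Γ) → ℕ → Set
  AValue g C k = ∃[ A ] ∃[ B ]
    (SplitPair g C A B × ∣ B ∣ ≤ ∣ A ∣ × ∣ A ∣ ≡ k ×
     (∀ A' B' → SplitPair g C A' B' → ∣ B' ∣ ≤ ∣ A' ∣ → ∣ A ∣ ∸ ∣ B ∣ ≤ ∣ A' ∣ ∸ ∣ B' ∣))

  -- contribution of a component C to min{a(X), c(X)}:
  -- a(C) if C is splittable, |C| otherwise
  CompValue : ℕ → Subset (N Γ) → ℕ → Set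
  CompValue g C k = (Splittable g C × AValue g C k) ⊎ (¬ Splittable g C × k ≡ ∣ C ∣)

  MinAC : ℕ → Subset (N Γ) → ℕ → Set
  MinAC g X k =
    (∃[ C ] (IsComponent (∁ X) C × CompValue g C k)) ×
    (∀ C j → IsComponent (∁ X) C → CompValue g C j → k ≤ j)

  GCNumber : ℕ → ℕ → Set
  GCNumber g k =
    (∃[ X ] ∃[ j ] (GoodNeighborCut g X × MinAC g X j × ∣ X ∣ + j ≡ k)) ×
    (∀ X j → GoodNeighborCut g X → MinAC g X j → k ≤ ∣ X ∣ + j)

Admissible : ℕ → ℕ → ℕ → Set
Admissible n m g = 2 ≤ m × m ≤ n × g + 1 ≤ (m + n ∸ 4) Data.Nat./ 2

-- Lower bound: a good-neighbour cut X disconnects K n □ K m, whose connectivity is n + m − 2,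
-- and every component of the remainder, as well as every part of a splitting of one, has
-- minimum degree at least g and hence at least g + 1 vertices.
-- Upper bound: let C be the first g + 1 cells of column 0 and X the cells (a , b) for which
-- exactly one of a ≤ g and b = 0 holds.  Then C is a (g + 1)-clique component of the
-- remainder, too small to split; the other cells form K (n − g − 1) □ K (m − 1), of minimum
-- degree n + m − g − 4 ≥ g; and ∣ X ∣ + ∣ C ∣ = (g + 1)(m − 1) + n.  The minimum defining c^g
-- exists because every notion involved is decidable on a finite graph.
-- For n = m = 3 and g = 0 both bounds equal 5.

module Submission where

open import Data.Bool as Bool using (Bool; true; false; not; _∧_; _∨_)
open import Data.Empty using (⊥-elim)
open import Data.Fin using (Fin; zero; suc; combine; remQuot; splitAt; join; _↑ˡ_; _↑ʳ_; punchIn)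
open import Data.Fin.Properties as FinP using (all?; any?; 0≢1+n)
open import Data.Fin.Subset using (Subset; inside; outside; _∈_; _∉_; _⊆_; _⊂_; ∁; _∩_; _∪_; _─_; _-_; ⁅_⁆; ∣_∣; ⊥)
open import Data.Fin.Subset.Properties
open import Data.Nat as ℕ using (ℕ; zero; suc; _+_; _*_; _∸_; _≤_; _<_; z≤n; s≤s; _≤?_)
open import Data.Nat.DivMod using (m/n*n≤m)
open import Data.Nat.Induction using (<-rec)
open import Data.Nat.Tactic.RingSolver using (solve-∀)
open import Data.Nat.Properties as ℕP using (≤-trans; ≤-refl; ≤-reflexive; +-mono-≤; +-monoʳ-≤; +-suc; ≮⇒≥; <⇒≱; anyUpTo?; allUpTo?)
open import Data.Product as Prod using (∃-syntax; _×_; _,_; proj₁; proj₂)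
open import Data.Sum as Sum using (_⊎_; inj₁; inj₂)
open import Data.Vec using ([]; _∷_; tabulate; here; there)
open import Data.Vec.Properties using (lookup∘tabulate; []=⇒lookup; lookup⇒[]=; ≡-dec)
open import Function using (_∘_; id; case_of_)
open import Function.Definitions using (Injective)
open import Relation.Binary.PropositionalEquality using (_≡_; _≢_; refl; sym; trans; cong; cong₂; subst; subst₂)
open import Relation.Nullary using (¬_; Dec; yes; no)
open import Relation.Nullary.Decidable using (⌊_⌋; isYes≗does; dec-true; dec-false; _×-dec_; _→-dec_; _⊎-dec_; ¬?; map′; decidable-stable)
open import Relation.Unary using (Pred; Decidable)

open import Defs

private variable
  k n : ℕ

⌊i≟i⌋≡true : ∀ (i : Fin n) → ⌊ i FinP.≟ i ⌋ ≡ true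
⌊i≟i⌋≡true i = trans (isYes≗does (i FinP.≟ i)) (dec-true (i FinP.≟ i) refl)

i≢j⇒⌊i≟j⌋≡false : ∀ {i j : Fin n} → i ≢ j → ⌊ i FinP.≟ j ⌋ ≡ false
i≢j⇒⌊i≟j⌋≡false {i = i} {j} i≢j = trans (isYes≗does (i FinP.≟ j)) (dec-false (i FinP.≟ j) i≢j)

∈tabulate⁺ : ∀ {f : Fin n → Bool} {x} → f x ≡ true → x ∈ tabulate f
∈tabulate⁺ {f = f} {x} fx = lookup⇒[]= x _ (trans (lookup∘tabulate f x) fx)

∈tabulate⁻ : ∀ {f : Fin n → Bool} {x} → x ∈ tabulate f → f x ≡ true
∈tabulate⁻ {f = f} {x} x∈ = trans (sym (lookup∘tabulate f x)) ([]=⇒lookup x∈)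

x∈p─q⇒x∉q : ∀ {x : Fin n} {p q : Subset n} → x ∈ p ─ q → x ∉ q
x∈p─q⇒x∉q {p = _ ∷ _} {q = outside ∷ _} here        ()
x∈p─q⇒x∉q {p = _ ∷ _} {q = _ ∷ _}       (there x∈) (there x∈q) = x∈p─q⇒x∉q x∈ x∈q

x∉p-x : ∀ (p : Subset n) x → x ∉ p - x
x∉p-x p x x∈ = x∈p─q⇒x∉q x∈ (x∈⁅x⁆ x)

∣p∪q∣≤∣p∣+∣q∣ : ∀ (p q : Subset n) → ∣ p ∪ q ∣ ≤ ∣ p ∣ + ∣ q ∣
∣p∪q∣≤∣p∣+∣q∣ []            []            = z≤n
∣p∪q∣≤∣p∣+∣q∣ (outside ∷ p) (outside ∷ q) = ∣p∪q∣≤∣p∣+∣q∣ p q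
∣p∪q∣≤∣p∣+∣q∣ (outside ∷ p) (inside ∷ q)  =
  ≤-trans (s≤s (∣p∪q∣≤∣p∣+∣q∣ p q)) (≤-reflexive (sym (+-suc ∣ p ∣ ∣ q ∣)))
∣p∪q∣≤∣p∣+∣q∣ (inside ∷ p)  (s ∷ q)       =
  s≤s (≤-trans (∣p∪q∣≤∣p∣+∣q∣ p q) (+-monoʳ-≤ ∣ p ∣ (∣p∣≤∣x∷p∣ s q)))

∣⁅x⁆∪p∣≤1+∣p∣ : ∀ (x : Fin n) p → ∣ ⁅ x ⁆ ∪ p ∣ ≤ suc ∣ p ∣
∣⁅x⁆∪p∣≤1+∣p∣ x p = ≤-trans (∣p∪q∣≤∣p∣+∣q∣ ⁅ x ⁆ p) (ℕP.+-monoˡ-≤ ∣ p ∣ (≤-reflexive (∣⁅x⁆∣≡1 x)))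

image : (Fin k → Fin n) → Subset n
image {zero}  f = ⊥
image {suc k} f = ⁅ f zero ⁆ ∪ image (f ∘ suc)

∈-image : ∀ (f : Fin k → Fin n) i → f i ∈ image f
∈-image f zero    = x∈p∪q⁺ (inj₁ (x∈⁅x⁆ (f zero)))
∈-image f (suc i) = x∈p∪q⁺ (inj₂ (∈-image (f ∘ suc) i))

∈-image⁻ : ∀ (f : Fin k → Fin n) {y} → y ∈ image f → ∃[ i ] f i ≡ y
∈-image⁻ {zero}  f y∈ = ⊥-elim (∉⊥ y∈)
∈-image⁻ {suc k} f y∈ with x∈p∪q⁻ ⁅ f zero ⁆ (image (f ∘ suc)) y∈
... | inj₁ y∈⁅f0⁆ = zero , sym (x∈⁅y⁆⇒x≡y _ y∈⁅f0⁆)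
... | inj₂ y∈rest = Prod.map suc id (∈-image⁻ (f ∘ suc) y∈rest)

∣image∣≤ : ∀ (f : Fin k → Fin n) → ∣ image f ∣ ≤ k
∣image∣≤ {zero}  {n} f = ≤-reflexive (∣⊥∣≡0 n)
∣image∣≤ {suc k} f = ≤-trans (∣⁅x⁆∪p∣≤1+∣p∣ (f zero) _) (s≤s (∣image∣≤ (f ∘ suc)))

injective⇒≤∣p∣ : ∀ {p : Subset n} (f : Fin k → Fin n) → Injective _≡_ _≡_ f → (∀ i → f i ∈ p) → k ≤ ∣ p ∣
injective⇒≤∣p∣ {k = zero}  f _   _   = z≤n
injective⇒≤∣p∣ {k = suc k} f inj f∈ = ≤-trans (s≤s (injective⇒≤∣p∣ (f ∘ suc) (FinP.suc-injective ∘ inj) f∘suc∈))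
                                               (x∈p⇒∣p-x∣<∣p∣ (f∈ zero))
  where
  f∘suc∈ : ∀ i → f (suc i) ∈ _ - f zero
  f∘suc∈ i = x∈p∧x≢y⇒x∈p-y (f∈ (suc i)) (0≢1+n ∘ sym ∘ inj)

injective⊎⇒≤∣p∣ : ∀ {a b} {p : Subset n} (f : Fin a ⊎ Fin b → Fin n) → Injective _≡_ _≡_ f →
                  (∀ i → f i ∈ p) → a + b ≤ ∣ p ∣
injective⊎⇒≤∣p∣ {a = a} {b} f inj f∈ = injective⇒≤∣p∣ (f ∘ splitAt a) (splitAt-injective ∘ inj) (f∈ ∘ splitAt a)
  where
  splitAt-injective : Injective _≡_ _≡_ (splitAt a {b})
  splitAt-injective {i} {j} eq =
    trans (sym (FinP.join-splitAt a b i)) (trans (cong (join a b) eq) (FinP.join-splitAt a b j))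

Least : ∀ {ℓ} → Pred ℕ ℓ → Set ℓ
Least P = ∃[ i ] (P i × (∀ {j} → P j → i ≤ j))

least : ∀ {ℓ} {P : Pred ℕ ℓ} → Decidable P → ∀ {k} → P k → Least P
least {P = P} P? {k} = <-rec (λ k → P k → Least P) search k
  where
  search : ∀ k → (∀ {i} → i < k → P i → Least P) → P k → Least P
  search k below pk with anyUpTo? P? k
  ... | yes (i , i<k , pi) = below i<k pi
  ... | no nothing-below   = k , pk , λ pj → ≮⇒≥ (λ j<k → nothing-below (_ , j<k , pj))

allSubset? : ∀ {ℓ} {P : Pred (Subset n) ℓ} → Decidable P → Dec (∀ p → P p)
allSubset? P? = map′ (λ ¬counterexample p → decidable-stable (P? p) (¬counterexample ∘ (p ,_)))
                     (λ all (p , ¬Pp) → ¬Pp (all p))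
                     (¬? (anySubset? (¬? ∘ P?)))

lowerBound? : ∀ {ℓ} {Q : Pred ℕ ℓ} → Decidable Q → ∀ k → Dec (∀ j → Q j → k ≤ j)
lowerBound? Q? k with allUpTo? (¬? ∘ Q?) k
... | yes none-below = yes λ j Qj → ≮⇒≥ λ j<k → none-below j<k Qj
... | no ¬none-below = no λ bound → ¬none-below λ j<k Qj → <⇒≱ j<k (bound _ Qj)

module _ (Γ : Graph) where

  ClosedIn : Subset (N Γ) → Subset (N Γ) → Set
  ClosedIn S U = ∀ x y → x ∈ U → y ∈ S → adj Γ x y ≡ true → y ∈ U

  ∈-∩nbr : ∀ {S y} x → y ∈ S → adj Γ x y ≡ true → y ∈ S ∩ nbr Γ x
  ∈-∩nbr x y∈S xy = x∈p∩q⁺ (y∈S , ∈tabulate⁺ xy)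

  reach-start : ∀ {S x y} → Reach Γ S x y → x ∈ S
  reach-start (here x∈S)     = x∈S
  reach-start (step x∈S _ _) = x∈S

  reach-mono : ∀ {S T x y} → S ⊆ T → Reach Γ S x y → Reach Γ T x y
  reach-mono S⊆T (here x∈S)       = here (S⊆T x∈S)
  reach-mono S⊆T (step x∈S xz r) = step (S⊆T x∈S) xz (reach-mono S⊆T r)

  reach-closed : ∀ {S U x y} → ClosedIn S U → x ∈ U → Reach Γ S x y → y ∈ U
  reach-closed closed x∈U (here _)                 = x∈U
  reach-closed closed x∈U (step {x} {z} _ xz r) = reach-closed closed (closed x z x∈U (reach-start r) xz) r

  -- The tail of a walk after its last visit to x.
  reach-after-last : ∀ {S a y} x → y ≢ x → Reach Γ S a y →
                     Reach Γ (S - x) a y ⊎ ∃[ z ] (adj Γ x z ≡ true × Reach Γ (S - x) z y)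
  reach-after-last x y≢x (here y∈S) = inj₁ (here (x∈p∧x≢y⇒x∈p-y y∈S y≢x))
  reach-after-last x y≢x (step {a} {b} a∈S ab r) with reach-after-last x y≢x r
  ... | inj₂ tail = inj₂ tail
  ... | inj₁ r′ with a FinP.≟ x
  ...   | yes refl = inj₂ (b , ab , r′)
  ...   | no a≢x   = inj₁ (step (x∈p∧x≢y⇒x∈p-y a∈S a≢x) ab r′)

  reach? : ∀ S x y → Dec (Reach Γ S x y)
  reach? S = within (N Γ) S (∣p∣≤n S)
    where
    within : ∀ k S → ∣ S ∣ ≤ k → ∀ x y → Dec (Reach Γ S x y)
    within k S _ x y with x ∈? S | x FinP.≟ y
    ... | no x∉S  | _        = no (x∉S ∘ reach-start)
    ... | yes x∈S | yes refl = yes (here x∈S)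
    within zero    S ∣S∣≤0 x y | yes x∈S | no _ =
      ⊥-elim (<⇒≱ (x∈p⇒∣p-x∣<∣p∣ x∈S) (≤-trans ∣S∣≤0 z≤n))
    within (suc k) S ∣S∣≤ x y | yes x∈S | no x≢y =
      map′ (λ (z , xz , r) → step x∈S xz (reach-mono (p─q⊆p S ⁅ x ⁆) r)) leave
           (any? λ z → adj Γ x z Bool.≟ true ×-dec within k (S - x) ∣S-x∣≤k z y)
      where
      ∣S-x∣≤k : ∣ S - x ∣ ≤ k
      ∣S-x∣≤k = ℕP.≤-pred (≤-trans (x∈p⇒∣p-x∣<∣p∣ x∈S) ∣S∣≤)
      leave : Reach Γ S x y → ∃[ z ] (adj Γ x z ≡ true × Reach Γ (S - x) z y)
      leave r with reach-after-last x (x≢y ∘ sym) r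
      ... | inj₁ r′   = ⊥-elim (x∉p-x S x (reach-start r′))
      ... | inj₂ tail = tail

  minDegAtLeast? : ∀ g S → Dec (MinDegAtLeast Γ g S)
  minDegAtLeast? g S = all? λ x → x ∈? S →-dec g ≤? degIn Γ S x

  connected? : ∀ S → Dec (Connected Γ S)
  connected? S = all? λ x → all? λ y → x ∈? S →-dec y ∈? S →-dec reach? S x y

  disconnected? : ∀ S → Dec (Disconnected Γ S)
  disconnected? S = any? λ x → any? λ y → x ∈? S ×-dec y ∈? S ×-dec ¬? (reach? S x y)

  closedIn? : ∀ S U → Dec (ClosedIn S U)
  closedIn? S U = all? λ x → all? λ y → x ∈? U →-dec y ∈? S →-dec adj Γ x y Bool.≟ true →-dec y ∈? U

  isComponent? : ∀ S C → Dec (IsComponent Γ S C)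
  isComponent? S C = C ⊆? S ×-dec nonempty? C ×-dec connected? C ×-dec closedIn? S C

  goodNeighborCut? : ∀ g X → Dec (GoodNeighborCut Γ g X)
  goodNeighborCut? g X = disconnected? (∁ X) ×-dec minDegAtLeast? g (∁ X)

  splitPair? : ∀ g C A B → Dec (SplitPair Γ g C A B)
  splitPair? g C A B = ≡-dec Bool._≟_ (A ∪ B) C ×-dec ¬? (nonempty? (A ∩ B)) ×-dec nonempty? A ×-dec
                       nonempty? B ×-dec minDegAtLeast? g A ×-dec minDegAtLeast? g B

  splittable? : ∀ g C → Dec (Splittable Γ g C)
  splittable? g C = anySubset? λ A → anySubset? λ B → splitPair? g C A B

  aValue? : ∀ g C k → Dec (AValue Γ g C k)
  aValue? g C k = anySubset? λ A → anySubset? λ B →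
    splitPair? g C A B ×-dec ∣ B ∣ ≤? ∣ A ∣ ×-dec ∣ A ∣ ℕ.≟ k ×-dec
    (allSubset? λ A′ → allSubset? λ B′ →
      splitPair? g C A′ B′ →-dec ∣ B′ ∣ ≤? ∣ A′ ∣ →-dec ∣ A ∣ ∸ ∣ B ∣ ≤? ∣ A′ ∣ ∸ ∣ B′ ∣)

  compValue? : ∀ g C k → Dec (CompValue Γ g C k)
  compValue? g C k = (splittable? g C ×-dec aValue? g C k) ⊎-dec (¬? (splittable? g C) ×-dec k ℕ.≟ ∣ C ∣)

  minAC? : ∀ g X k → Dec (MinAC Γ g X k)
  minAC? g X k =
    (anySubset? λ C → isComponent? (∁ X) C ×-dec compValue? g C k) ×-dec
    map′ (λ bound C j comp val → bound C j (comp , val)) (λ bound C j (comp , val) → bound C j comp val)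
         (allSubset? λ C → lowerBound? (λ j → isComponent? (∁ X) C ×-dec compValue? g C j) k)

  Attained : ℕ → ℕ → Set
  Attained g k = ∃[ X ] ∃[ j ] (GoodNeighborCut Γ g X × MinAC Γ g X j × ∣ X ∣ + j ≡ k)

  attained? : ∀ g k → Dec (Attained g k)
  attained? g k = anySubset? λ X →
    map′ (λ (j , _ , attains) → j , attains) (λ (j , attains) → j , j<1+k attains , attains)
         (anyUpTo? (λ j → goodNeighborCut? g X ×-dec minAC? g X j ×-dec ∣ X ∣ + j ℕ.≟ k) (suc k))
    where
    j<1+k : ∀ {X j} → GoodNeighborCut Γ g X × MinAC Γ g X j × ∣ X ∣ + j ≡ k → j < suc k
    j<1+k {X} {j} (_ , _ , refl) = s≤s (ℕP.m≤n+m j ∣ X ∣)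

  gcNumber-exists : ∀ {g X j} → GoodNeighborCut Γ g X → MinAC Γ g X j →
                    ∃[ k ] (GCNumber Γ g k × k ≤ ∣ X ∣ + j)
  gcNumber-exists {g} {X} {j} cut min = from-least (least {P = Attained g} (attained? g) (X , j , cut , min , refl))
    where
    from-least : Least (Attained g) → ∃[ k ] (GCNumber Γ g k × k ≤ ∣ X ∣ + j)
    from-least (k , attained , minimal) =
      k , (attained , λ X′ j′ cut′ min′ → minimal (X′ , j′ , cut′ , min′ , refl))
        , minimal (X , j , cut , min , refl)

module _ (Γ : Graph) (loopless : ∀ x → adj Γ x x ≡ false) where

  degIn<∣S∣ : ∀ {S x} → x ∈ S → degIn Γ S x < ∣ S ∣
  degIn<∣S∣ {S} {x} x∈S = p⊂q⇒∣p∣<∣q∣ (p∩q⊆p S (nbr Γ x) , x , x∈S , x∉nbr ∘ proj₂ ∘ x∈p∩q⁻ S (nbr Γ x))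
    where
    x∉nbr : x ∉ nbr Γ x
    x∉nbr x∈ with trans (sym (∈tabulate⁻ x∈)) (loopless x)
    ... | ()

  g≤degIn⇒g<∣S∣ : ∀ {g S x} → x ∈ S → g ≤ degIn Γ S x → g < ∣ S ∣
  g≤degIn⇒g<∣S∣ x∈S g≤deg = ≤-trans (s≤s g≤deg) (degIn<∣S∣ x∈S)

  g<compValue : ∀ {g X C j} → GoodNeighborCut Γ g X → IsComponent Γ (∁ X) C → CompValue Γ g C j → g < j
  g<compValue _ _ (inj₁ (_ , A , B , (_ , _ , (a , a∈A) , _ , δA , _) , _ , refl , _)) = g≤degIn⇒g<∣S∣ a∈A (δA a a∈A)
  g<compValue {X = X} {C} (_ , δ) (C⊆∁X , (x , x∈C) , _ , closed) (inj₂ (_ , refl)) =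
    g≤degIn⇒g<∣S∣ x∈C (≤-trans (δ x (C⊆∁X x∈C)) (p⊆q⇒∣p∣≤∣q∣ nbr-in-C))
    where
    nbr-in-C : ∁ X ∩ nbr Γ x ⊆ C ∩ nbr Γ x
    nbr-in-C y∈ with x∈p∩q⁻ (∁ X) (nbr Γ x) y∈
    ... | y∈∁X , y∈nbr = x∈p∩q⁺ (closed x _ x∈C y∈∁X (∈tabulate⁻ y∈nbr) , y∈nbr)

  g<minAC : ∀ {g X j} → GoodNeighborCut Γ g X → MinAC Γ g X j → g < j
  g<minAC cut ((_ , comp , val) , _) = g<compValue cut comp val

  small⇒¬splittable : ∀ {g C} → ∣ C ∣ ≤ suc g → ¬ Splittable Γ g C
  small⇒¬splittable ∣C∣≤ (A , B , refl , disjoint , (a , a∈A) , (b , b∈B) , δA , _) =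
    <⇒≱ (ℕP.≤-<-trans (g≤degIn⇒g<∣S∣ a∈A (δA a a∈A)) (p⊂q⇒∣p∣<∣q∣ A⊂A∪B)) ∣C∣≤
    where
    A⊂A∪B : A ⊂ A ∪ B
    A⊂A∪B = p⊆p∪q B , b , x∈p∪q⁺ (inj₂ b∈B) , λ b∈A → disjoint (b , x∈p∩q⁺ (b∈A , b∈B))

  small-component⇒minAC : ∀ {g X C} → GoodNeighborCut Γ g X → IsComponent Γ (∁ X) C → ∣ C ∣ ≤ suc g →
                          MinAC Γ g X ∣ C ∣
  small-component⇒minAC cut comp ∣C∣≤ =
    (_ , comp , inj₂ (small⇒¬splittable ∣C∣≤ , refl)) , λ _ _ comp′ val′ → ≤-trans ∣C∣≤ (g<compValue cut comp′ val′)

-- K n □ K m is the n × m rook's graph: cell (a , b) is combine a b, and two cells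
-- are adjacent iff they agree in exactly one coordinate.
module Rook (n m : ℕ) where

  Γ : Graph
  Γ = K n □ K m

  data Cell : Fin (n * m) → Set where
    cell : ∀ (a : Fin n) (b : Fin m) → Cell (combine a b)

  cell-view : ∀ x → Cell x
  cell-view x = subst Cell (FinP.combine-remQuot {n} m x) (cell _ _)

  rookAdj : Fin n × Fin m → Fin n × Fin m → Bool
  rookAdj (a , b) (a′ , b′) = (⌊ a FinP.≟ a′ ⌋ ∧ not ⌊ b FinP.≟ b′ ⌋) ∨ (⌊ b FinP.≟ b′ ⌋ ∧ not ⌊ a FinP.≟ a′ ⌋)

  adj-remQuot : ∀ x y → adj Γ x y ≡ rookAdj (remQuot m x) (remQuot m y)
  adj-remQuot x y with remQuot {n} m x | remQuot {n} m y
  ... | _ , _ | _ , _ = refl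

  adj-combine : ∀ a b a′ b′ → adj Γ (combine a b) (combine a′ b′) ≡ rookAdj (a , b) (a′ , b′)
  adj-combine a b a′ b′ =
    trans (adj-remQuot (combine a b) (combine a′ b′))
          (cong₂ rookAdj (FinP.remQuot-combine a b) (FinP.remQuot-combine a′ b′))

  adj-row : ∀ a b b′ → b ≢ b′ → adj Γ (combine a b) (combine a b′) ≡ true
  adj-row a b b′ b≢b′
    rewrite adj-combine a b a b′ | ⌊i≟i⌋≡true a | i≢j⇒⌊i≟j⌋≡false b≢b′ = refl

  adj-col : ∀ a a′ b → a ≢ a′ → adj Γ (combine a b) (combine a′ b) ≡ true
  adj-col a a′ b a≢a′
    rewrite adj-combine a b a′ b | ⌊i≟i⌋≡true b | i≢j⇒⌊i≟j⌋≡false a≢a′ = refl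

  adj⇒ : ∀ a b a′ b′ → adj Γ (combine a b) (combine a′ b′) ≡ true → a ≡ a′ ⊎ b ≡ b′
  adj⇒ a b a′ b′ adjacent rewrite adj-combine a b a′ b′ with a FinP.≟ a′ | b FinP.≟ b′
  ... | yes a≡a′ | _        = inj₁ a≡a′
  ... | no _     | yes b≡b′ = inj₂ b≡b′

  loopless : ∀ x → adj Γ x x ≡ false
  loopless x with cell-view x
  ... | cell a b rewrite adj-combine a b a b | ⌊i≟i⌋≡true a | ⌊i≟i⌋≡true b = refl

  -- Every column w meets X in row u or u′
  -- (block the walk x, (u , w), (u′ , w), y), and every row t ∉ {u , u′} meets X in column v or
  -- v′ (block x, (t , v), (t , v′), y).  Sending rows u and u′ to x and y themselves gives
  -- n + m distinct cells of X ∪ {x , y}.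
  module Separated {X : Subset (n * m)} {u u′ : Fin n} {v v′ : Fin m}
                   (x∈ : combine u v ∈ ∁ X) (y∈ : combine u′ v′ ∈ ∁ X)
                   (x↛y : ¬ Reach Γ (∁ X) (combine u v) (combine u′ v′)) where

    private
      x y : Fin (n * m)
      x = combine u v
      y = combine u′ v′

    blocks₂ : ∀ {z} → adj Γ x z ≡ true → adj Γ z y ≡ true → z ∈ X
    blocks₂ xz zy = x∉∁p⇒x∈p λ z∈ → x↛y (step x∈ xz (step z∈ zy (here y∈)))

    blocks₃ : ∀ {z z′} → adj Γ x z ≡ true → adj Γ z z′ ≡ true → adj Γ z′ y ≡ true → z ∈ X ⊎ z′ ∈ X
    blocks₃ {z} xz zz′ z′y with z ∈? X
    ... | yes z∈X = inj₁ z∈X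
    ... | no z∉X  = inj₂ (x∉∁p⇒x∈p λ z′∈ → x↛y (step x∈ xz (step (x∉p⇒x∈∁p z∉X) zz′ (step z′∈ z′y (here y∈)))))

    u≢u′ : u ≢ u′
    u≢u′ refl with v FinP.≟ v′
    ... | yes refl  = x↛y (here x∈)
    ... | no v≢v′   = x↛y (step x∈ (adj-row u v v′ v≢v′) (here y∈))

    v≢v′ : v ≢ v′
    v≢v′ refl = x↛y (step x∈ (adj-col u u′ v u≢u′) (here y∈))

    colRow : Fin m → Fin n
    colRow w with combine u w ∈? X
    ... | yes _ = u
    ... | no _  = u′

    colRow≡u⊎u′ : ∀ w → colRow w ≡ u ⊎ colRow w ≡ u′
    colRow≡u⊎u′ w with combine u w ∈? X
    ... | yes _ = inj₁ refl
    ... | no _  = inj₂ refl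

    colHit∈X : ∀ w → combine (colRow w) w ∈ X
    colHit∈X w with combine u w ∈? X
    ... | yes uw∈X = uw∈X
    ... | no uw∉X with w FinP.≟ v | w FinP.≟ v′
    ...   | yes refl | _        = blocks₂ (adj-col u u′ v u≢u′) (adj-row u′ v v′ v≢v′)
    ...   | no _     | yes refl = ⊥-elim (uw∉X (blocks₂ (adj-row u v v′ v≢v′) (adj-col u u′ v′ u≢u′)))
    ...   | no w≢v   | no w≢v′ with blocks₃ (adj-row u v w (w≢v ∘ sym)) (adj-col u u′ w u≢u′) (adj-row u′ w v′ w≢v′)
    ...     | inj₁ uw∈X  = ⊥-elim (uw∉X uw∈X)
    ...     | inj₂ u′w∈X = u′w∈X

    rowCol : Fin n → Fin m
    rowCol t with t FinP.≟ u | t FinP.≟ u′ | combine t v ∈? X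
    ... | yes _ | _     | _     = v
    ... | no _  | yes _ | _     = v′
    ... | no _  | no _  | yes _ = v
    ... | no _  | no _  | no _  = v′

    rowCol-u : rowCol u ≡ v
    rowCol-u with u FinP.≟ u
    ... | yes _   = refl
    ... | no u≢u = ⊥-elim (u≢u refl)

    rowCol-u′ : rowCol u′ ≡ v′
    rowCol-u′ with u′ FinP.≟ u | u′ FinP.≟ u′
    ... | yes u′≡u | _          = ⊥-elim (u≢u′ (sym u′≡u))
    ... | no _     | yes _      = refl
    ... | no _     | no u′≢u′ = ⊥-elim (u′≢u′ refl)

    rowHit∈ : ∀ t → combine t (rowCol t) ∈ ⁅ x ⁆ ∪ ⁅ y ⁆ ∪ X
    rowHit∈ t with t FinP.≟ u | t FinP.≟ u′ | combine t v ∈? X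
    ... | yes refl | _        | _     = x∈p∪q⁺ (inj₁ (x∈⁅x⁆ x))
    ... | no _     | yes refl | _     = x∈p∪q⁺ (inj₂ (x∈p∪q⁺ (inj₁ (x∈⁅x⁆ y))))
    ... | no _     | no _     | yes tv∈X = x∈p∪q⁺ (inj₂ (x∈p∪q⁺ (inj₂ tv∈X)))
    ... | no t≢u   | no t≢u′  | no tv∉X
      with blocks₃ (adj-col u t v (t≢u ∘ sym)) (adj-row t v v′ v≢v′) (adj-col t u′ v′ t≢u′)
    ...   | inj₁ tv∈X  = ⊥-elim (tv∉X tv∈X)
    ...   | inj₂ tv′∈X = x∈p∪q⁺ (inj₂ (x∈p∪q⁺ (inj₂ tv′∈X)))

    cornerRowHit∉X : ∀ {t} → t ≡ u ⊎ t ≡ u′ → combine t (rowCol t) ∉ X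
    cornerRowHit∉X (inj₁ refl) = subst (_∉ X) (cong (combine u) (sym rowCol-u)) (x∈∁p⇒x∉p x∈)
    cornerRowHit∉X (inj₂ refl) = subst (_∉ X) (cong (combine u′) (sym rowCol-u′)) (x∈∁p⇒x∉p y∈)

    rowHit≢colHit : ∀ t w → combine t (rowCol t) ≢ combine (colRow w) w
    rowHit≢colHit t w eq =
      cornerRowHit∉X (Sum.map (trans t≡) (trans t≡) (colRow≡u⊎u′ w)) (subst (_∈ X) (sym eq) (colHit∈X w))
      where
      t≡ : t ≡ colRow w
      t≡ = proj₁ (FinP.combine-injective t (rowCol t) (colRow w) w eq)

    hit : Fin n ⊎ Fin m → Fin (n * m)
    hit (inj₁ t) = combine t (rowCol t)
    hit (inj₂ w) = combine (colRow w) w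

    hit-injective : Injective _≡_ _≡_ hit
    hit-injective {inj₁ t} {inj₁ t′} eq = cong inj₁ (proj₁ (FinP.combine-injective t _ t′ _ eq))
    hit-injective {inj₂ w} {inj₂ w′} eq = cong inj₂ (proj₂ (FinP.combine-injective (colRow w) w (colRow w′) w′ eq))
    hit-injective {inj₁ t} {inj₂ w} eq = ⊥-elim (rowHit≢colHit t w eq)
    hit-injective {inj₂ w} {inj₁ t} eq = ⊥-elim (rowHit≢colHit t w (sym eq))

    hit∈ : ∀ i → hit i ∈ ⁅ x ⁆ ∪ ⁅ y ⁆ ∪ X
    hit∈ (inj₁ t) = rowHit∈ t
    hit∈ (inj₂ w) = x∈p∪q⁺ (inj₂ (x∈p∪q⁺ (inj₂ (colHit∈X w))))

    n+m≤2+∣X∣ : n + m ≤ 2 + ∣ X ∣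
    n+m≤2+∣X∣ = ≤-trans (injective⊎⇒≤∣p∣ hit hit-injective hit∈)
                        (≤-trans (∣⁅x⁆∪p∣≤1+∣p∣ x _) (s≤s (∣⁅x⁆∪p∣≤1+∣p∣ y X)))

  disconnected⇒n+m≤2+∣X∣ : ∀ {X} → Disconnected Γ (∁ X) → n + m ≤ 2 + ∣ X ∣
  disconnected⇒n+m≤2+∣X∣ (x , y , x∈ , y∈ , x↛y) with cell-view x | cell-view y
  ... | cell _ _ | cell _ _ = Separated.n+m≤2+∣X∣ x∈ y∈ x↛y

  gcNumber-≥ : ∀ {g k} → GCNumber Γ g k → n + m ∸ 1 + g ≤ k
  gcNumber-≥ {g} ((X , j , cut , min , refl) , _) =
    ≤-trans (ℕP.+-monoˡ-≤ g (ℕP.∸-monoˡ-≤ 1 (disconnected⇒n+m≤2+∣X∣ (proj₁ cut))))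
            (≤-trans (≤-reflexive (sym (+-suc ∣ X ∣ g))) (+-monoʳ-≤ ∣ X ∣ (g<minAC Γ loopless cut min)))

-- The case n = (g + 1) + (d₁ + 1), m = d₂ + 2, with rows split into g + 1 low rows p ↑ˡ _
-- and d₁ + 1 high rows _ ↑ʳ r.
module Construction (g d₁ d₂ : ℕ) (g≤d₁+d₂ : g ≤ d₁ + d₂) where

  open Rook (suc g + suc d₁) (suc (suc d₂))

  private
    V = Fin (N Γ)
    VSet = Subset (N Γ)

  data Row : Fin (suc g + suc d₁) → Set where
    low  : (p : Fin (suc g))  → Row (p ↑ˡ suc d₁)
    high : (r : Fin (suc d₁)) → Row (suc g ↑ʳ r)

  row-view : ∀ a → Row a
  row-view a with splitAt (suc g) a in eq
  ... | inj₁ p = subst Row (FinP.splitAt⁻¹-↑ˡ eq) (low p)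
  ... | inj₂ r = subst Row (FinP.splitAt⁻¹-↑ʳ eq) (high r)

  low≢high : ∀ p r → p ↑ˡ suc d₁ ≢ suc g ↑ʳ r
  low≢high p r eq with trans (sym (FinP.splitAt-↑ˡ (suc g) p (suc d₁)))
                             (trans (cong (splitAt (suc g)) eq) (FinP.splitAt-↑ʳ (suc g) (suc d₁) r))
  ... | ()

  coreCell : Fin (suc g) → V
  coreCell p = combine (p ↑ˡ suc d₁) zero

  lowCell : Fin (suc g) → Fin (suc d₂) → V
  lowCell p q = combine (p ↑ˡ suc d₁) (suc q)

  highCell : Fin (suc d₁) → V
  highCell r = combine (suc g ↑ʳ r) zero

  farCell : Fin (suc d₁) → Fin (suc d₂) → V
  farCell r q = combine (suc g ↑ʳ r) (suc q)

  lowCells : Fin (suc g * suc d₂) → V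
  lowCells = Prod.uncurry lowCell ∘ remQuot (suc d₂)

  core≢low : ∀ p p′ q → coreCell p ≢ lowCell p′ q
  core≢low p p′ q = 0≢1+n ∘ FinP.combine-injectiveʳ (p ↑ˡ suc d₁) zero (p′ ↑ˡ suc d₁) (suc q)

  core≢high : ∀ p r → coreCell p ≢ highCell r
  core≢high p r = low≢high p r ∘ FinP.combine-injectiveˡ (p ↑ˡ suc d₁) zero (suc g ↑ʳ r) zero

  core≢far : ∀ p r q → coreCell p ≢ farCell r q
  core≢far p r q = 0≢1+n ∘ FinP.combine-injectiveʳ (p ↑ˡ suc d₁) zero (suc g ↑ʳ r) (suc q)

  far≢low : ∀ r q p q′ → farCell r q ≢ lowCell p q′
  far≢low r q p q′ = low≢high p r ∘ sym ∘ FinP.combine-injectiveˡ (suc g ↑ʳ r) (suc q) (p ↑ˡ suc d₁) (suc q′)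

  far≢high : ∀ r q r′ → farCell r q ≢ highCell r′
  far≢high r q r′ = 0≢1+n ∘ sym ∘ FinP.combine-injectiveʳ (suc g ↑ʳ r) (suc q) (suc g ↑ʳ r′) zero

  -- Opaque: letting unification unfold these concrete subsets is prohibitively expensive.
  opaque
    C X : VSet
    C = image coreCell
    X = image lowCells ∪ image highCell

    coreCell∈C : ∀ p → coreCell p ∈ C
    coreCell∈C = ∈-image coreCell

    ∈C⁻ : ∀ {x} → x ∈ C → ∃[ p ] coreCell p ≡ x
    ∈C⁻ = ∈-image⁻ coreCell

    ∣C∣≤ : ∣ C ∣ ≤ suc g
    ∣C∣≤ = ∣image∣≤ coreCell

    lowCell∈X : ∀ p q → lowCell p q ∈ X
    lowCell∈X p q = x∈p∪q⁺ (inj₁ (subst (_∈ image lowCells) (cong (Prod.uncurry lowCell) (FinP.remQuot-combine p q))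
                                        (∈-image lowCells (combine p q))))

    highCell∈X : ∀ r → highCell r ∈ X
    highCell∈X r = x∈p∪q⁺ (inj₂ (∈-image highCell r))

    ∈X⁻ : ∀ {x} → x ∈ X → (∃[ p ] ∃[ q ] lowCell p q ≡ x) ⊎ (∃[ r ] highCell r ≡ x)
    ∈X⁻ x∈X with x∈p∪q⁻ (image lowCells) (image highCell) x∈X
    ... | inj₂ x∈high = inj₂ (∈-image⁻ highCell x∈high)
    ... | inj₁ x∈low with ∈-image⁻ lowCells x∈low
    ...   | i , eq = inj₁ (proj₁ (remQuot {suc g} (suc d₂) i) , proj₂ (remQuot {suc g} (suc d₂) i) , eq)

    ∣X∣≤ : ∣ X ∣ ≤ suc g * suc d₂ + suc d₁
    ∣X∣≤ = ≤-trans (∣p∪q∣≤∣p∣+∣q∣ (image lowCells) (image highCell))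
                   (+-mono-≤ (∣image∣≤ lowCells) (∣image∣≤ highCell))

  coreCell∈∁X : ∀ p → coreCell p ∈ ∁ X
  coreCell∈∁X p = x∉p⇒x∈∁p λ x∈X → case ∈X⁻ x∈X of λ where
    (inj₁ (p′ , q , eq)) → core≢low p p′ q (sym eq)
    (inj₂ (r , eq))      → core≢high p r (sym eq)

  farCell∈∁X : ∀ r q → farCell r q ∈ ∁ X
  farCell∈∁X r q = x∉p⇒x∈∁p λ x∈X → case ∈X⁻ x∈X of λ where
    (inj₁ (p , q′ , eq)) → far≢low r q p q′ (sym eq)
    (inj₂ (r′ , eq))     → far≢high r q r′ (sym eq)

  coreCell-adj : ∀ {p p′} → p ≢ p′ → adj Γ (coreCell p) (coreCell p′) ≡ true
  coreCell-adj {p} {p′} p≢p′ = adj-col (p ↑ˡ suc d₁) (p′ ↑ˡ suc d₁) zero (p≢p′ ∘ FinP.↑ˡ-injective (suc d₁) p p′)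

  coreCell-injective : Injective _≡_ _≡_ coreCell
  coreCell-injective {p} {p′} =
    FinP.↑ˡ-injective (suc d₁) p p′ ∘ FinP.combine-injectiveˡ (p ↑ˡ suc d₁) zero (p′ ↑ˡ suc d₁) zero

  farCell-injective : ∀ {r q r′ q′} → farCell r q ≡ farCell r′ q′ → r ≡ r′ × q ≡ q′
  farCell-injective {r} {q} {r′} {q′} eq with FinP.combine-injective (suc g ↑ʳ r) (suc q) (suc g ↑ʳ r′) (suc q′) eq
  ... | rows , cols = FinP.↑ʳ-injective (suc g) r r′ rows , FinP.suc-injective cols

  C-closed : ClosedIn Γ (∁ X) C
  C-closed _ y x∈C y∈∁X xy with ∈C⁻ x∈C | cell-view y
  ... | p , refl | cell a b with row-view a | b
  ...   | low p′ | zero  = coreCell∈C p′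
  ...   | low p′ | suc q = ⊥-elim (x∈∁p⇒x∉p y∈∁X (lowCell∈X p′ q))
  ...   | high r | zero  = ⊥-elim (x∈∁p⇒x∉p y∈∁X (highCell∈X r))
  ...   | high r | suc q = case adj⇒ (p ↑ˡ suc d₁) zero (suc g ↑ʳ r) (suc q) xy of λ where
    (inj₁ rows) → ⊥-elim (low≢high p r rows)
    (inj₂ ())

  C-connected : Connected Γ C
  C-connected x y x∈C y∈C with ∈C⁻ x∈C | ∈C⁻ y∈C
  ... | p , refl | p′ , refl with p FinP.≟ p′
  ...   | yes refl = here x∈C
  ...   | no p≢p′  = step x∈C (coreCell-adj p≢p′) (here y∈C)

  C-component : IsComponent Γ (∁ X) C
  C-component = (λ x∈C → let (p , eq) = ∈C⁻ x∈C in subst (_∈ ∁ X) eq (coreCell∈∁X p))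
              , (coreCell zero , coreCell∈C zero)
              , C-connected
              , C-closed

  ∁X-disconnected : Disconnected Γ (∁ X)
  ∁X-disconnected = coreCell zero , farCell zero zero , coreCell∈∁X zero , farCell∈∁X zero zero , core↛far
    where
    core↛far : ¬ Reach Γ (∁ X) (coreCell zero) (farCell zero zero)
    core↛far r = let (p , eq) = ∈C⁻ (reach-closed Γ C-closed (coreCell∈C zero) r) in core≢far p zero zero eq

  coreCell-degree : ∀ p → g ≤ degIn Γ (∁ X) (coreCell p)
  coreCell-degree p = injective⇒≤∣p∣ (coreCell ∘ punchIn p)
    (FinP.punchIn-injective p _ _ ∘ coreCell-injective)
    (λ i → ∈-∩nbr Γ (coreCell p) (coreCell∈∁X (punchIn p i)) (coreCell-adj (FinP.punchInᵢ≢i p i ∘ sym)))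

  farCell-degree : ∀ r q → d₁ + d₂ ≤ degIn Γ (∁ X) (farCell r q)
  farCell-degree r q = injective⊎⇒≤∣p∣ neighbour neighbour-injective neighbour∈
    where
    neighbour : Fin d₁ ⊎ Fin d₂ → V
    neighbour (inj₁ i) = farCell (punchIn r i) q
    neighbour (inj₂ j) = farCell r (punchIn q j)

    neighbour-injective : Injective _≡_ _≡_ neighbour
    neighbour-injective {inj₁ i} {inj₁ i′} eq =
      cong inj₁ (FinP.punchIn-injective r i i′ (proj₁ (farCell-injective eq)))
    neighbour-injective {inj₂ j} {inj₂ j′} eq =
      cong inj₂ (FinP.punchIn-injective q j j′ (proj₂ (farCell-injective eq)))
    neighbour-injective {inj₁ i} {inj₂ j}  eq = ⊥-elim (FinP.punchInᵢ≢i r i (proj₁ (farCell-injective eq)))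
    neighbour-injective {inj₂ j} {inj₁ i}  eq = ⊥-elim (FinP.punchInᵢ≢i r i (sym (proj₁ (farCell-injective eq))))

    neighbour∈ : ∀ i → neighbour i ∈ ∁ X ∩ nbr Γ (farCell r q)
    neighbour∈ (inj₁ i) = ∈-∩nbr Γ (farCell r q) (farCell∈∁X (punchIn r i) q)
      (adj-col (suc g ↑ʳ r) (suc g ↑ʳ punchIn r i) (suc q)
               (FinP.punchInᵢ≢i r i ∘ sym ∘ FinP.↑ʳ-injective (suc g) r (punchIn r i)))
    neighbour∈ (inj₂ j) = ∈-∩nbr Γ (farCell r q) (farCell∈∁X r (punchIn q j))
      (adj-row (suc g ↑ʳ r) (suc q) (suc (punchIn q j)) (FinP.punchInᵢ≢i q j ∘ sym ∘ FinP.suc-injective))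

  ∁X-minDeg : MinDegAtLeast Γ g (∁ X)
  ∁X-minDeg x x∈∁X with cell-view x
  ... | cell a b with row-view a | b
  ...   | low p  | zero  = coreCell-degree p
  ...   | low p  | suc q = ⊥-elim (x∈∁p⇒x∉p x∈∁X (lowCell∈X p q))
  ...   | high r | zero  = ⊥-elim (x∈∁p⇒x∉p x∈∁X (highCell∈X r))
  ...   | high r | suc q = ≤-trans g≤d₁+d₂ (farCell-degree r q)

  X-cut : GoodNeighborCut Γ g X
  X-cut = ∁X-disconnected , ∁X-minDeg

  gcNumber-≤ : ∃[ k ] (GCNumber Γ g k × k ≤ (g + 1) * suc d₂ + (suc g + suc d₁))
  gcNumber-≤ = Prod.map₂ (Prod.map₂ (λ k≤ → ≤-trans k≤ ∣X∣+∣C∣≤))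
    (gcNumber-exists Γ X-cut (small-component⇒minAC Γ loopless X-cut C-component ∣C∣≤))
    where
    size : ∀ g d₁ d₂ → suc g * suc d₂ + suc d₁ + suc g ≡ (g + 1) * suc d₂ + (suc g + suc d₁)
    size = solve-∀
    ∣X∣+∣C∣≤ : ∣ X ∣ + ∣ C ∣ ≤ (g + 1) * suc d₂ + (suc g + suc d₁)
    ∣X∣+∣C∣≤ = ≤-trans (+-mono-≤ ∣X∣≤ ∣C∣≤) (≤-reflexive (size g d₁ d₂))

2[g+1]≤d+n⇒g≤n : ∀ {g d n} → d ≤ n → (g + 1) * 2 ≤ d + n → g ≤ n
2[g+1]≤d+n⇒g≤n {g} {d} {n} d≤n 2[g+1]≤d+n =
  ℕP.m+n≤o⇒m≤o g (ℕP.*-cancelʳ-≤ (g + 1) n 2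
    (≤-trans 2[g+1]≤d+n (≤-trans (ℕP.+-monoˡ-≤ n d≤n) (≤-reflexive (n+n≡n*2 n)))))
  where
  n+n≡n*2 : ∀ n → n + n ≡ n * 2
  n+n≡n*2 = solve-∀

2[g+1]≤d₂+[g+d₁]⇒g≤d₁+d₂ : ∀ g d₁ d₂ → (g + 1) * 2 ≤ d₂ + (g + d₁) → g ≤ d₁ + d₂
2[g+1]≤d₂+[g+d₁]⇒g≤d₁+d₂ g d₁ d₂ 2[g+1]≤ =
  ℕP.m+n≤o⇒m≤o g (ℕP.+-cancelˡ-≤ g (g + 2) (d₁ + d₂) (subst₂ _≤_ (lhs g) (rhs g d₁ d₂) 2[g+1]≤))
  where
  lhs : ∀ g → (g + 1) * 2 ≡ g + (g + 2)
  lhs = solve-∀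
  rhs : ∀ g d₁ d₂ → d₂ + (g + d₁) ≡ g + (d₁ + d₂)
  rhs = solve-∀

admissible⇒shape : ∀ {n m g} → Admissible n m g →
                   ∃[ d₁ ] ∃[ d₂ ] (n ≡ suc g + suc d₁ × m ≡ suc (suc d₂) × g ≤ d₁ + d₂)
admissible⇒shape {suc (suc n′)} {suc (suc d₂)} {g} (s≤s (s≤s z≤n) , s≤s (s≤s d₂≤n′) , g+1≤half)
  with ℕP.m≤n⇒∃[o]m+o≡n {g} (2[g+1]≤d+n⇒g≤n d₂≤n′ 2[g+1]≤d₂+n′) | 2[g+1]≤d₂+n′
  where
  2[g+1]≤d₂+n′ : (g + 1) * 2 ≤ d₂ + n′
  2[g+1]≤d₂+n′ = subst ((g + 1) * 2 ≤_) (cong (_∸ 2) (trans (+-suc d₂ (suc n′)) (cong suc (+-suc d₂ n′))))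
                       (≤-trans (ℕP.*-monoˡ-≤ 2 g+1≤half) (m/n*n≤m (d₂ + suc (suc n′) ∸ 2) 2))
... | d₁ , refl | 2[g+1]≤ = d₁ , d₂ , cong suc (sym (+-suc g d₁)) , refl , 2[g+1]≤d₂+[g+d₁]⇒g≤d₁+d₂ g d₁ d₂ 2[g+1]≤

Bounds : ℕ → ℕ → ℕ → Set
Bounds n m g = ∃[ k ] (GCNumber (K n □ K m) g k × n + m ∸ 1 + g ≤ k × k ≤ (g + 1) * (m ∸ 1) + n)

bounds : ∀ n m g → Admissible n m g → Bounds n m g
bounds n m g adm with admissible⇒shape adm
... | d₁ , d₂ , refl , refl , g≤d₁+d₂ =
  Prod.map₂ (λ (gc , k≤) → gc , Rook.gcNumber-≥ (suc g + suc d₁) (suc (suc d₂)) gc , k≤)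
            (Construction.gcNumber-≤ g d₁ d₂ g≤d₁+d₂)

bounds-meet : ∀ {n m g} → n + m ∸ 1 + g ≡ (g + 1) * (m ∸ 1) + n → Bounds n m g →
              GCNumber (K n □ K m) g (n + m ∸ 1 + g)
bounds-meet {n} {m} {g} lower≡upper (k , gc , lower≤k , k≤upper) =
  subst (GCNumber (K n □ K m) g) (ℕP.≤-antisym (≤-trans k≤upper (≤-reflexive (sym lower≡upper))) lower≤k) gc

proposition6p3 : ((n m g : ℕ) → Admissible n m g →
    ∃[ k ] (GCNumber (K n □ K m) g k × n + m ∸ 1 + g ≤ k × k ≤ (g + 1) * (m ∸ 1) + n))
    × (∃[ n ] ∃[ m ] ∃[ g ] (Admissible n m g × GCNumber (K n □ K m) g (n + m ∸ 1 + g)))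
    × (∃[ n ] ∃[ m ] ∃[ g ] (Admissible n m g × GCNumber (K n □ K m) g ((g + 1) * (m ∸ 1) + n)))
proposition6p3 = bounds , (3 , 3 , 0 , admissible , tight) , (3 , 3 , 0 , admissible , tight)
  where
  admissible : Admissible 3 3 0
  admissible = s≤s (s≤s z≤n) , ≤-refl , ≤-refl

  tight : GCNumber (K 3 □ K 3) 0 5
  tight = bounds-meet {3} {3} {0} refl (bounds 3 3 0 admissible)
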